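{- Let $G$ be a graph of order $n$ with $m$ edges and degree sequence $d_1\le d_2\le\cdots\le d_n$. Then $\alpha(G)\le p_2(G)\le p_1(G)\le p(G)$, where $p(G):=\lfloor\frac{1}{2}+\sqrt{\frac{1}{4}+n^2-n-2m}\rfloor$ and $p_1(G):=\max\{i\mid d_i\le n-i\}$.
   Context: Graphs are finite and simple; $\alpha(G)$ is the independence number, $N(u)$ the neighbourhood and $d(u)=|N(u)|$ the degree of a vertex $u$. For a vertex $u$, consider all vertices $v\ne u$ not adjacent to $u$ (there are $t-1$ of them, where $t=n-d(u)$), and let $n_2(u)\le n_3(u)\le\cdots\le n_t(u)$ be the nondecreasing sequence of the values $|N(u)\cup N(v)|$ over these vertices $v$. Define $p_2(G):=\max\{k \mid G \text{ has at least } k \text{ vertices } v \text{ with } n_k(v)\le n-k\}$, where for a vertex $v$ the condition $n_k(v)\le n-k$ with $k\ge 2$ requires $k\le n-d(v)$ (so that $n_k(v)$ is defined), and for $k=1$ the condition is regarded as satisfied by every vertex. -}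

module Defs where

open import Data.Bool using (Bool; true; false; not; _∧_; _∨_; if_then_else_)
open import Data.Nat using (ℕ; zero; suc; _+_; _*_; _∸_; _≤_; _≤ᵇ_; _<ᵇ_; _/_)
open import Data.Nat.Properties using (≤-decTotalOrder)
open import Data.Fin using (Fin; toℕ)
open import Data.List using (List; []; _∷_; map; filterᵇ; length; allFin)
import Data.List as L
open import Data.Nat.ListAction using (sum)
open import Data.Bool.ListAction using (and)
open import Data.List.Sort.InsertionSort ≤-decTotalOrder using (sort)
open import Data.Maybe using (Maybe; just; nothing)
open import Relation.Binary.PropositionalEquality using (_≡_; _≢_)
open import Relation.Nullary using (¬_)
open import Relation.Nullary.Decidable using (does)
open import Data.Fin using (_≟_)

record Graph : Set where
  field
    n     : ℕ
    adj   : Fin n → Fin n → Bool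
    sym   : ∀ u v → adj u v ≡ adj v u
    irrefl : ∀ u → adj u u ≡ false
open Graph public

count : {A : Set} → (A → Bool) → List A → ℕ
count p xs = length (filterᵇ p xs)

maxUpTo : (ℕ → Bool) → ℕ → ℕ
maxUpTo p zero    = 0
maxUpTo p (suc b) = if p (suc b) then suc b else maxUpTo p b

maxList : List ℕ → ℕ
maxList = L.foldr Data.Nat._⊔_ 0

isqrt : ℕ → ℕ
isqrt y = maxUpTo (λ r → r * r ≤ᵇ y) y

-- the k-th element (1-indexed) of a list, if it exists
nth : List ℕ → ℕ → Maybe ℕ
nth []       _             = nothing
nth (x ∷ xs) zero          = nothing
nth (x ∷ xs) (suc zero)    = just x
nth (x ∷ xs) (suc (suc k)) = nth xs (suc k)

module _ (G : Graph) where

  V : List (Fin (n G))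
  V = allFin (n G)

  deg : Fin (n G) → ℕ
  deg u = count (adj G u) V

  edges : ℕ
  edges = sum (map (λ u → count (λ v → (toℕ u <ᵇ toℕ v) ∧ adj G u v) V) V)

  unionSize : Fin (n G) → Fin (n G) → ℕ
  unionSize u v = count (λ w → adj G u w ∨ adj G v w) V

  degSeq : List ℕ
  degSeq = sort (map deg V)

  p₁cond : ℕ → Bool
  p₁cond i with nth degSeq i
  ... | just dᵢ = dᵢ ≤ᵇ (n G ∸ i)
  ... | nothing = false

  p₁ : ℕ
  p₁ = maxUpTo p₁cond (n G)

  -- p(G) = ⌊ 1/2 + √(1/4 + n² − n − 2m) ⌋ = ⌊ (1 + √(1 + 4(n² − n − 2m))) / 2 ⌋
  --      = ⌊ (1 + ⌊√(1 + 4(n² − n − 2m))⌋) / 2 ⌋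
  pG : ℕ
  pG = (1 + isqrt (1 + 4 * (n G * n G ∸ n G ∸ 2 * edges))) / 2

  -- the nondecreasing sequence n₂(u) ≤ n₃(u) ≤ ⋯ ≤ n_t(u) of the values
  -- |N(u) ∪ N(v)| over vertices v ≠ u not adjacent to u
  nonNbrUnionSeq : Fin (n G) → List ℕ
  nonNbrUnionSeq u =
    sort (map (unionSize u)
              (filterᵇ (λ v → not (does (u ≟ v)) ∧ not (adj G u v)) V))

  -- n_k(u) for k ≥ 2 is the (k−1)-th element of that list
  -- (defined iff k ≤ t = n − d(u)).
  -- Condition "n_k(v) ≤ n − k", with the convention that it holds for k = 1
  -- for every vertex (and vacuously for k = 0, which never matters).
  p₂cond : ℕ → Fin (n G) → Bool
  p₂cond zero v          = true
  p₂cond (suc zero) v    = true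
  p₂cond (suc (suc j)) v with nth (nonNbrUnionSeq v) (suc j)
  ... | just nk = nk ≤ᵇ (n G ∸ suc (suc j))
  ... | nothing = false

  -- p₂(G) = max { k | G has at least k vertices v with n_k(v) ≤ n − k }
  -- (k ≤ n necessarily, since there are only n vertices)
  p₂ : ℕ
  p₂ = maxUpTo (λ k → k ≤ᵇ count (p₂cond k) V) (n G)

  independent : List (Fin (n G)) → Bool
  independent S = and (map (λ u → and (map (λ v → not (adj G u v)) S)) S)

  subsets : {A : Set} → List A → List (List A)
  subsets []       = [] ∷ []
  subsets (x ∷ xs) = let r = subsets xs in r L.++ map (x ∷_) r

  α : ℕ
  α = maxList (map length (filterᵇ independent (subsets V)))

module Submission where

-- α ≤ p₂: if S is independent with |S| = k, every v ∈ S has the k − 1 other members w of S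
-- as non-neighbours, and N(v) ∪ N(w) misses S, so n_k(v) ≤ n − k for all k vertices of S.
-- p₂ ≤ p₁: d(v) ≤ |N(v) ∪ N(w)| for every w, so k witnesses of p₂ are k vertices of degree
-- at most n − k, whence d_k ≤ n − k.
-- p₁ ≤ p: if d_k ≤ n − k then 2m = Σ dᵢ ≤ k(n − k) + (n − k)(n − 1), i.e.
-- n² − n − 2m ≥ k(k − 1), and 1/4 + k(k − 1) = (k − 1/2)² gives p ≥ k.

open import Data.Bool using (Bool; true; false; not; _∧_; _∨_; T)
open import Data.Bool.Properties using (T?; T-∧; T-∨; T-not-≡; ∧-assoc; ∧-zeroʳ)
open import Data.Fin using (Fin; zero; suc; toℕ; _≟_)
open import Data.Fin.Properties using (toℕ-injective)
open import Data.List using (List; []; _∷_; map; filterᵇ; length; allFin; tabulate)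
open import Data.List.Membership.Propositional using (_∈_)
open import Data.List.Membership.Propositional.Properties using (∈-allFin)
open import Data.List.Properties
  using (length-map; length-tabulate; map-cong; map-tabulate; filter-all; filter-accept; filter-none)
open import Data.List.Relation.Binary.Permutation.Propositional using (_↭_; ↭-sym)
open import Data.List.Relation.Binary.Permutation.Propositional.Properties
  using (↭-length; filter-↭; All-resp-↭)
open import Data.List.Relation.Binary.Sublist.Propositional using (_⊆_; []; _∷_; _∷ʳ_; ⊆-refl; from∈)
open import Data.List.Relation.Binary.Sublist.Propositional.Properties using (filter⁺; length-mono-≤)
open import Data.List.Relation.Unary.All as All using (All; []; _∷_)
open import Data.List.Relation.Unary.All.Properties
  using (all⁺; all-filter) renaming (filter⁺ to All-filter⁺; map⁺ to All-map⁺; ++⁺ to All-++⁺)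
open import Data.List.Relation.Unary.AllPairs using (AllPairs; []; _∷_)
open import Data.List.Relation.Unary.Linked.Properties using (Linked⇒AllPairs)
open import Data.Maybe using (just)
open import Data.Nat using (ℕ; zero; suc; _+_; _*_; _∸_; _≤_; _≤ᵇ_; _<ᵇ_; z≤n; s≤s; _/_)
open import Data.Nat.DivMod using (m*n/n≡m; /-monoˡ-≤)
open import Data.Nat.ListAction using (sum)
open import Data.Nat.ListAction.Properties using (sum-↭)
open import Data.Nat.Properties hiding (_≟_)
open import Data.Nat.Solver using (module +-*-Solver)
open import Data.Product using (_×_; _,_; proj₁; uncurry; ∃-syntax)
open import Data.Sum using (inj₁; inj₂)
open import Function using (_∘_)
open import Function.Bundles using (Equivalence)
open import Relation.Binary.PropositionalEquality as ≡
  using (_≡_; _≢_; refl; cong; cong₂; subst; module ≡-Reasoning)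
open import Relation.Nullary using (does; yes; no; ¬_; contradiction)

open import Algebra.Properties.CommutativeSemigroup +-commutativeSemigroup using (x∙yz≈y∙xz; interchange)
open import Data.List.Sort.InsertionSort ≤-decTotalOrder using (sort)
open import Data.List.Sort.InsertionSort.Properties ≤-decTotalOrder using (sort-↭; sort-↗)

open import Defs

private variable A B : Set

count-mono : (p q : A → Bool) → (∀ x → T (p x) → T (q x)) → ∀ xs → count p xs ≤ count q xs
count-mono p q p⇒q xs =
  length-mono-≤ (filter⁺ (T? ∘ p) (T? ∘ q) (λ { refl → p⇒q _ }) (⊆-refl {x = xs}))

count-≗ : (p q : A → Bool) → (∀ x → p x ≡ q x) → ∀ xs → count p xs ≡ count q xs
count-≗ p q p≗q xs = ≤-antisym (count-mono p q (λ x → subst T (p≗q x)) xs)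
                               (count-mono q p (λ x → subst T (≡.sym (p≗q x))) xs)

count-accept : (p : A → Bool) {x : A} {xs : List A} → T (p x) → count p (x ∷ xs) ≡ suc (count p xs)
count-accept p px = cong length (filter-accept (T? ∘ p) px)

count-none : (p : A → Bool) {xs : List A} → All (¬_ ∘ T ∘ p) xs → count p xs ≡ 0
count-none p ¬pxs = cong length (filter-none (T? ∘ p) ¬pxs)

count-↭ : (p : A → Bool) {xs ys : List A} → xs ↭ ys → count p xs ≡ count p ys
count-↭ p = ↭-length ∘ filter-↭ (T? ∘ p)

count-map : (p : B → Bool) (f : A → B) → ∀ xs → count p (map f xs) ≡ count (p ∘ f) xs
count-map p f []       = refl
count-map p f (x ∷ xs) with p (f x)
... | true  = cong suc (count-map p f xs)
... | false = count-map p f xs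

count-filterᵇ : (p q : A → Bool) → ∀ xs → count p (filterᵇ q xs) ≡ count (λ x → q x ∧ p x) xs
count-filterᵇ p q []       = refl
count-filterᵇ p q (x ∷ xs) with q x
... | false = count-filterᵇ p q xs
... | true with p x
...   | true  = cong suc (count-filterᵇ p q xs)
...   | false = count-filterᵇ p q xs

count-∧-split : (q p : A → Bool) → ∀ xs →
                count p xs ≡ count (λ x → q x ∧ p x) xs + count (λ x → not (q x) ∧ p x) xs
count-∧-split q p []       = refl
count-∧-split q p (x ∷ xs) with q x | p x
... | true  | true  = cong suc (count-∧-split q p xs)
... | false | true  = ≡.trans (cong suc (count-∧-split q p xs)) (≡.sym (+-suc _ _))
... | true  | false = count-∧-split q p xs
... | false | false = count-∧-split q p xs

count-+-count-not : (p : A → Bool) → ∀ xs → count p xs + count (not ∘ p) xs ≡ length xs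
count-+-count-not p []       = refl
count-+-count-not p (x ∷ xs) with p x
... | true  = cong suc (count-+-count-not p xs)
... | false = ≡.trans (+-suc _ _) (cong suc (count-+-count-not p xs))

length≤count : (p : A → Bool) {ys xs : List A} → ys ⊆ xs → All (T ∘ p) ys → length ys ≤ count p xs
length≤count p {ys} {xs} ys⊆xs pys = subst (_≤ count p xs) (cong length (filter-all (T? ∘ p) pys))
  (length-mono-≤ (filter⁺ (T? ∘ p) (T? ∘ p) (λ { refl px → px }) ys⊆xs))

count+length≤length : (p : A → Bool) {ys xs : List A} → ys ⊆ xs → All (T ∘ not ∘ p) ys →
                      count p xs + length ys ≤ length xs
count+length≤length p {ys} {xs} ys⊆xs ¬pys = begin
  count p xs + length ys            ≤⟨ +-monoʳ-≤ (count p xs) (length≤count (not ∘ p) ys⊆xs ¬pys) ⟩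
  count p xs + count (not ∘ p) xs   ≡⟨ count-+-count-not p xs ⟩
  length xs                         ∎
  where open ≤-Reasoning

count-tabulate-suc : ∀ n {p : Fin (suc n) → Bool} →
                     count p (tabulate suc) ≡ count (p ∘ suc) (allFin n)
count-tabulate-suc n {p} =
  ≡.trans (cong (count p) (≡.sym (map-tabulate (λ i → i) suc))) (count-map p suc (allFin n))

count-≟-allFin : ∀ n (v : Fin n) → count (λ w → does (v ≟ w)) (allFin n) ≡ 1
count-≟-allFin (suc n) zero    =
  cong suc (≡.trans (count-tabulate-suc n) (count-none _ (All.universal (λ _ ()) (allFin n))))
count-≟-allFin (suc n) (suc v) = ≡.trans (count-tabulate-suc n) (count-≟-allFin n v)

count≤1+count-≢ : ∀ {n} (v : Fin n) (p : Fin n → Bool) →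
                  count p (allFin n) ≤ suc (count (λ w → not (does (v ≟ w)) ∧ p w) (allFin n))
count≤1+count-≢ {n} v p = begin
  count p (allFin n)                                  ≡⟨ count-∧-split (does ∘ (v ≟_)) p (allFin n) ⟩
  count (λ w → does (v ≟ w) ∧ p w) (allFin n) + rest  ≤⟨ +-monoˡ-≤ rest drop-p ⟩
  count (λ w → does (v ≟ w)) (allFin n) + rest        ≡⟨ cong (_+ rest) (count-≟-allFin n v) ⟩
  suc rest                                            ∎
  where
  open ≤-Reasoning
  rest = count (λ w → not (does (v ≟ w)) ∧ p w) (allFin n)
  drop-p = count-mono _ _ (λ w → proj₁ ∘ Equivalence.to T-∧) (allFin n)

sum-map-+ : (f g : A → ℕ) → ∀ xs →
            sum (map (λ x → f x + g x) xs) ≡ sum (map f xs) + sum (map g xs)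
sum-map-+ f g []       = refl
sum-map-+ f g (x ∷ xs) =
  ≡.trans (cong (f x + g x +_) (sum-map-+ f g xs)) (interchange (f x) (g x) _ _)

sum-count-∷ : (g : B → A → Bool) (x : A) (xs : List A) → ∀ ys →
              sum (map (λ y → count (g y) (x ∷ xs)) ys) ≡
              count (λ y → g y x) ys + sum (map (λ y → count (g y) xs) ys)
sum-count-∷ g x xs []       = refl
sum-count-∷ g x xs (y ∷ ys) rewrite sum-count-∷ g x xs ys with g y x
... | true  = cong suc (x∙yz≈y∙xz (count (g y) xs) (count (λ y → g y x) ys) rest)
  where rest = sum (map (λ y → count (g y) xs) ys)
... | false = x∙yz≈y∙xz (count (g y) xs) (count (λ y → g y x) ys) rest
  where rest = sum (map (λ y → count (g y) xs) ys)

sum-count-swap : (f : A → B → Bool) → ∀ xs ys →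
                 sum (map (λ x → count (f x) ys) xs) ≡ sum (map (λ y → count (λ x → f x y) xs) ys)
sum-count-swap f []       ys = ≡.sym (sum-zeros ys)
  where
  sum-zeros : ∀ ys → sum (map (λ _ → 0) ys) ≡ 0
  sum-zeros []       = refl
  sum-zeros (_ ∷ ys) = sum-zeros ys
sum-count-swap f (x ∷ xs) ys = ≡.trans (cong (count (f x) ys +_) (sum-count-swap f xs ys))
                                       (≡.sym (sum-count-∷ (λ y x → f x y) x xs ys))

nth-All : ∀ {P : ℕ → Set} {ys k x} → All P ys → nth ys k ≡ just x → P x
nth-All {ys = y ∷ ys} {suc zero}    (py ∷ _)   refl = py
nth-All {ys = y ∷ ys} {suc (suc k)} (_  ∷ pys) eq   = nth-All pys eq

nth-≤-sorted : ∀ {b} j ys → AllPairs _≤_ ys → suc j ≤ count (_≤ᵇ b) ys →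
               ∃[ x ] nth ys (suc j) ≡ just x × x ≤ b
nth-≤-sorted {b} j (y ∷ ys) (y≤ys ∷ sorted) enough with y ≤? b
... | no y≰b = contradiction (≤-trans enough (≤-reflexive none-≤-b)) λ ()
  where
  above-b : ∀ {x} → y ≤ x → ¬ T (x ≤ᵇ b)
  above-b y≤x x≤b = y≰b (≤-trans y≤x (≤ᵇ⇒≤ _ b x≤b))
  none-≤-b : count (_≤ᵇ b) (y ∷ ys) ≡ 0
  none-≤-b = count-none (_≤ᵇ b) {y ∷ ys} (above-b ≤-refl ∷ All.map above-b y≤ys)
... | yes y≤b with j
...   | zero   = y , refl , y≤b
...   | suc j′ = nth-≤-sorted j′ ys sorted (≤-pred (≤-trans enough (≤-reflexive y-counted)))
  where y-counted = count-accept (_≤ᵇ b) {y} (≤⇒≤ᵇ y≤b)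

sum≤length* : ∀ {M} ys → All (_≤ M) ys → sum ys ≤ length ys * M
sum≤length* []       []         = z≤n
sum≤length* (y ∷ ys) (y≤M ∷ ys≤M) = +-mono-≤ y≤M (sum≤length* ys ys≤M)

-- The first k entries are at most the k-th one, the others at most M.
sum-sorted-≤ : ∀ {M d} j ys → AllPairs _≤_ ys → All (_≤ M) ys → nth ys (suc j) ≡ just d →
               sum ys ≤ suc j * d + (length ys ∸ suc j) * M
sum-sorted-≤ zero (y ∷ ys) _ (_ ∷ ys≤M) refl =
  +-mono-≤ (≤-reflexive (≡.sym (*-identityˡ y))) (sum≤length* ys ys≤M)
sum-sorted-≤ {M} {d} (suc j) (y ∷ ys) (y≤ys ∷ sorted) (_ ∷ ys≤M) eq = begin
  y + sum ys
    ≤⟨ +-mono-≤ (nth-All y≤ys eq) (sum-sorted-≤ j ys sorted ys≤M eq) ⟩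
  d + (suc j * d + (length ys ∸ suc j) * M)   ≡⟨ ≡.sym (+-assoc d _ _) ⟩
  suc (suc j) * d + (length ys ∸ suc j) * M   ∎
  where open ≤-Reasoning

maxUpTo-lub : ∀ p b {c} → (∀ k → T (p (suc k)) → suc k ≤ b → suc k ≤ c) → maxUpTo p b ≤ c
maxUpTo-lub p zero    _ = z≤n
maxUpTo-lub p (suc b) h with p (suc b) | h b
... | true  | top = top _ ≤-refl
... | false | _   = maxUpTo-lub p b (λ k pk k<b → h k pk (m≤n⇒m≤1+n k<b))

maxUpTo≤bound : ∀ p b → maxUpTo p b ≤ b
maxUpTo≤bound p b = maxUpTo-lub p b (λ _ _ k≤b → k≤b)

maxUpTo-≤-suc : ∀ p b → maxUpTo p b ≤ maxUpTo p (suc b)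
maxUpTo-≤-suc p b with p (suc b)
... | true  = m≤n⇒m≤1+n (maxUpTo≤bound p b)
... | false = ≤-refl

maxUpTo-top : ∀ p b → T (p (suc b)) → maxUpTo p (suc b) ≡ suc b
maxUpTo-top p b top with p (suc b)
... | true = refl

maxUpTo-ub : ∀ p {k} b → T (p k) → k ≤ b → k ≤ maxUpTo p b
maxUpTo-ub p {zero}  b       _  _   = z≤n
maxUpTo-ub p {suc k} (suc b) pk k≤b with m≤n⇒m<n∨m≡n k≤b
... | inj₁ k<b  = ≤-trans (maxUpTo-ub p b pk (≤-pred k<b)) (maxUpTo-≤-suc p b)
... | inj₂ refl = ≤-reflexive (≡.sym (maxUpTo-top p b pk))

maxList-lub : ∀ {c} xs → All (_≤ c) xs → maxList xs ≤ c
maxList-lub []       []          = z≤n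
maxList-lub (x ∷ xs) (x≤c ∷ xs≤c) = ⊔-lub x≤c (maxList-lub xs xs≤c)

isqrt-≥ : ∀ r y → r * r ≤ y → r ≤ isqrt y
isqrt-≥ zero    y _    = z≤n
isqrt-≥ (suc r) y r²≤y =
  maxUpTo-ub (λ r → r * r ≤ᵇ y) y (≤⇒≤ᵇ r²≤y) (≤-trans (m≤m*n (suc r) (suc r)) r²≤y)

-- 1 + 4k(k − 1) = (2k − 1)².
suc≤[1+isqrt[1+4y]]/2 : ∀ a y → suc a * a ≤ y → suc a ≤ (1 + isqrt (1 + 4 * y)) / 2
suc≤[1+isqrt[1+4y]]/2 a y h = begin
  suc a                          ≡⟨ ≡.sym (m*n/n≡m (suc a) 2) ⟩
  suc a * 2 / 2                  ≡⟨ cong (_/ 2) (solve 1 (λ a → (con 1 :+ a) :* con 2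
                                                             := con 1 :+ (con 2 :* a :+ con 1)) refl a) ⟩
  (1 + (2 * a + 1)) / 2          ≤⟨ /-monoˡ-≤ 2 (s≤s (isqrt-≥ (2 * a + 1) (1 + 4 * y) odd²≤)) ⟩
  (1 + isqrt (1 + 4 * y)) / 2    ∎
  where
  open ≤-Reasoning
  open +-*-Solver
  odd²≤ : (2 * a + 1) * (2 * a + 1) ≤ 1 + 4 * y
  odd²≤ = ≤-trans (≤-reflexive (solve 1 (λ a → (con 2 :* a :+ con 1) :* (con 2 :* a :+ con 1)
                                           := con 1 :+ con 4 :* ((con 1 :+ a) :* a)) refl a))
                  (s≤s (*-monoʳ-≤ 4 h))

n²∸n-split : ∀ a r → (suc a + r) * (suc a + r) ∸ (suc a + r) ≡ suc a * a + (suc a * r + r * (a + r))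
n²∸n-split a r = ≡.trans (m+n∸m≡n (suc a + r) ((a + r) * (suc a + r)))
  (solve 2 (λ a r → (a :+ r) :* (con 1 :+ a :+ r)
                   := (con 1 :+ a) :* a :+ ((con 1 :+ a) :* r :+ r :* (a :+ r))) refl a r)
  where open +-*-Solver

k[k∸1]≤n²∸n∸E : ∀ n a E → suc a ≤ n → E ≤ suc a * (n ∸ suc a) + (n ∸ suc a) * (n ∸ 1) →
                suc a * a ≤ n * n ∸ n ∸ E
k[k∸1]≤n²∸n∸E n a E k≤n E≤ with m≤n⇒∃[o]m+o≡n k≤n
... | r , refl rewrite m+n∸m≡n (suc a) r = begin
  suc a * a                 ≡⟨ ≡.sym (m+n∸n≡m (suc a * a) rest) ⟩
  suc a * a + rest ∸ rest   ≤⟨ ∸-monoʳ-≤ (suc a * a + rest) E≤ ⟩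
  suc a * a + rest ∸ E      ≡⟨ cong (_∸ E) (≡.sym (n²∸n-split a r)) ⟩
  (suc a + r) * (suc a + r) ∸ (suc a + r) ∸ E ∎
  where
  open ≤-Reasoning
  rest = suc a * r + r * (a + r)

not-<ᵇ : ∀ x y → x ≢ y → not (x <ᵇ y) ≡ (y <ᵇ x)
not-<ᵇ zero    zero    x≢y = contradiction refl x≢y
not-<ᵇ zero    (suc y) _   = refl
not-<ᵇ (suc x) zero    _   = refl
not-<ᵇ (suc x) (suc y) x≢y = not-<ᵇ x y (x≢y ∘ cong suc)

T-not-∨ : ∀ {a b} → T (not a) → T (not b) → T (not (a ∨ b))
T-not-∨ ¬a ¬b = Equivalence.from T-not-≡
  (cong₂ _∨_ (Equivalence.to T-not-≡ ¬a) (Equivalence.to T-not-≡ ¬b))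

All-sort : ∀ {P : ℕ → Set} {xs} → All P xs → All P (sort xs)
All-sort {xs = xs} = All-resp-↭ (↭-sym (sort-↭ xs))

sort-AllPairs : ∀ xs → AllPairs _≤_ (sort xs)
sort-AllPairs xs = Linked⇒AllPairs ≤-trans (sort-↗ xs)

module _ (G : Graph) where

  length-V : length (V G) ≡ n G
  length-V = length-tabulate (λ i → i)

  deg-split : ∀ u → deg G u ≡ count (λ v → (toℕ u <ᵇ toℕ v) ∧ adj G u v) (V G)
                              + count (λ v → (toℕ v <ᵇ toℕ u) ∧ adj G v u) (V G)
  deg-split u = ≡.trans (count-∧-split (λ v → toℕ u <ᵇ toℕ v) (adj G u) (V G))
                        (cong (count (λ v → (toℕ u <ᵇ toℕ v) ∧ adj G u v) (V G) +_)
                              (count-≗ _ _ from-larger-end (V G)))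
    where
    from-larger-end : ∀ v → not (toℕ u <ᵇ toℕ v) ∧ adj G u v ≡ (toℕ v <ᵇ toℕ u) ∧ adj G v u
    from-larger-end v rewrite sym G v u with adj G u v in uv
    ... | false = ≡.trans (∧-zeroʳ _) (≡.sym (∧-zeroʳ _))
    ... | true  = cong (_∧ true) (not-<ᵇ (toℕ u) (toℕ v) (λ u≡v → loop (toℕ-injective u≡v)))
      where
      loop : u ≢ v
      loop refl with () ← ≡.trans (≡.sym uv) (irrefl G u)

  -- Every edge is counted once from its smaller and once from its larger end.
  handshake : sum (map (deg G) (V G)) ≡ 2 * edges G
  handshake = begin
    sum (map (deg G) (V G))
      ≡⟨ cong sum (map-cong deg-split (V G)) ⟩
    sum (map (λ u → count (lower u) (V G) + count (λ v → lower v u) (V G)) (V G))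
      ≡⟨ sum-map-+ _ _ (V G) ⟩
    edges G + sum (map (λ u → count (λ v → lower v u) (V G)) (V G))
      ≡⟨ cong (edges G +_) (≡.sym (sum-count-swap lower (V G) (V G))) ⟩
    edges G + edges G
      ≡⟨ cong (edges G +_) (≡.sym (+-identityʳ (edges G))) ⟩
    2 * edges G
      ∎
    where
    open ≡-Reasoning
    lower : Fin (n G) → Fin (n G) → Bool
    lower u v = (toℕ u <ᵇ toℕ v) ∧ adj G u v

  unionSize+length≤n : ∀ {S u w} → S ⊆ V G → All (λ x → T (not (adj G u x ∨ adj G w x))) S →
                       unionSize G u w + length S ≤ n G
  unionSize+length≤n S⊆V avoid = ≤-trans (count+length≤length _ S⊆V avoid) (≤-reflexive length-V)

  deg≤n∸1 : ∀ u → deg G u ≤ n G ∸ 1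
  deg≤n∸1 u = m+n≤o⇒m≤o∸n (deg G u)
    (≤-trans (count+length≤length (adj G u) (from∈ (∈-allFin u)) (not-loop ∷ [])) (≤-reflexive length-V))
    where
    not-loop : T (not (adj G u u))
    not-loop = Equivalence.from T-not-≡ (irrefl G u)

  deg≤unionSize : ∀ u w → deg G u ≤ unionSize G u w
  deg≤unionSize u w = count-mono _ _ (λ x → Equivalence.from T-∨ ∘ inj₁) (V G)

  independent⇒nonadjacent : ∀ {S u v} → T (independent G S) → u ∈ S → v ∈ S → T (not (adj G u v))
  independent⇒nonadjacent {S} ind u∈S v∈S =
    All.lookup (all⁺ _ S (All.lookup (all⁺ _ S ind) u∈S)) v∈S

  unionSize≤n∸length : ∀ {S v w} → S ⊆ V G → T (independent G S) → v ∈ S → w ∈ S →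
                     unionSize G v w ≤ n G ∸ length S
  unionSize≤n∸length S⊆V ind v∈S w∈S = m+n≤o⇒m≤o∸n _ (unionSize+length≤n S⊆V (All.tabulate λ x∈S →
    T-not-∨ (independent⇒nonadjacent ind v∈S x∈S) (independent⇒nonadjacent ind w∈S x∈S)))

  degSeq-sorted : AllPairs _≤_ (degSeq G)
  degSeq-sorted = sort-AllPairs (map (deg G) (V G))

  nonNbrUnionSeq-sorted : ∀ v → AllPairs _≤_ (nonNbrUnionSeq G v)
  nonNbrUnionSeq-sorted v = sort-AllPairs (map (unionSize G v) (filterᵇ _ (V G)))

  length-degSeq : length (degSeq G) ≡ n G
  length-degSeq = ≡.trans (↭-length (sort-↭ (map (deg G) (V G))))
                          (≡.trans (length-map (deg G) (V G)) length-V)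

  count-nonNbrUnionSeq : ∀ v b → count (_≤ᵇ b) (nonNbrUnionSeq G v) ≡
    count (λ w → (not (does (v ≟ w)) ∧ not (adj G v w)) ∧ (unionSize G v w ≤ᵇ b)) (V G)
  count-nonNbrUnionSeq v b = begin
    count (_≤ᵇ b) (sort unions)                         ≡⟨ count-↭ (_≤ᵇ b) (sort-↭ unions) ⟩
    count (_≤ᵇ b) unions                                ≡⟨ count-map (_≤ᵇ b) (unionSize G v) nonNbrs ⟩
    count (λ w → unionSize G v w ≤ᵇ b) nonNbrs          ≡⟨ count-filterᵇ _ _ (V G) ⟩
    count (λ w → (not (does (v ≟ w)) ∧ not (adj G v w)) ∧ (unionSize G v w ≤ᵇ b)) (V G) ∎
    where
    open ≡-Reasoning
    nonNbrs = filterᵇ (λ w → not (does (v ≟ w)) ∧ not (adj G v w)) (V G)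
    unions = map (unionSize G v) nonNbrs

  p₂cond-intro : ∀ j v → (∃[ x ] nth (nonNbrUnionSeq G v) (suc j) ≡ just x × x ≤ n G ∸ suc (suc j)) →
                 T (p₂cond G (suc (suc j)) v)
  p₂cond-intro j v (x , eq , x≤) rewrite eq = ≤⇒≤ᵇ x≤

  deg≤nonNbrUnionSeq : ∀ u → All (deg G u ≤_) (nonNbrUnionSeq G u)
  deg≤nonNbrUnionSeq u = All-sort (All-map⁺ (All.universal (deg≤unionSize u) (filterᵇ _ (V G))))

  p₂cond⇒deg≤ : ∀ j u → T (p₂cond G (suc j) u) → deg G u ≤ n G ∸ suc j
  p₂cond⇒deg≤ zero     u _    = deg≤n∸1 u
  p₂cond⇒deg≤ (suc j) u cond with nth (nonNbrUnionSeq G u) (suc j) in eq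
  ... | just x = ≤-trans (nth-All (deg≤nonNbrUnionSeq u) eq) (≤ᵇ⇒≤ x _ cond)

  p₁cond-intro : ∀ i → (∃[ d ] nth (degSeq G) i ≡ just d × d ≤ n G ∸ i) → T (p₁cond G i)
  p₁cond-intro i (d , eq , d≤) rewrite eq = ≤⇒≤ᵇ d≤

  p₁cond-elim : ∀ i → T (p₁cond G i) → ∃[ d ] nth (degSeq G) i ≡ just d × d ≤ n G ∸ i
  p₁cond-elim i cond with nth (degSeq G) i
  ... | just d = d , refl , ≤ᵇ⇒≤ d _ cond

  independent⇒p₂cond : ∀ {S v} → S ⊆ V G → T (independent G S) → v ∈ S → T (p₂cond G (length S) v)
  independent⇒p₂cond {S} {v} S⊆V ind v∈S = at-size (length S) refl
    where
    at-size : ∀ k → length S ≡ k → T (p₂cond G k v)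
    at-size zero          _      = _
    at-size (suc zero)    _      = _
    at-size (suc (suc j)) |S|≡k =
      p₂cond-intro j v (nth-≤-sorted j _ (nonNbrUnionSeq-sorted v) (≤-pred enough))
      where
      b = n G ∸ suc (suc j)
      P : Fin (n G) → Bool
      P w = not (adj G v w) ∧ (unionSize G v w ≤ᵇ b)
      in-S : ∀ {w} → w ∈ S → T (P w)
      in-S {w} w∈S = Equivalence.from T-∧ (independent⇒nonadjacent ind v∈S w∈S ,
        ≤⇒≤ᵇ (subst (λ k → unionSize G v w ≤ n G ∸ k) |S|≡k (unionSize≤n∸length S⊆V ind v∈S w∈S)))
      enough : suc (suc j) ≤ suc (count (_≤ᵇ b) (nonNbrUnionSeq G v))
      enough = begin
        suc (suc j)                                          ≡⟨ ≡.sym |S|≡k ⟩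
        length S                                             ≤⟨ length≤count P S⊆V (All.tabulate in-S) ⟩
        count P (V G)                                        ≤⟨ count≤1+count-≢ v P ⟩
        suc (count (λ w → not (does (v ≟ w)) ∧ P w) (V G))   ≡⟨ cong suc (count-≗ _ _ reassoc (V G)) ⟩
        suc (count (λ w → (not (does (v ≟ w)) ∧ not (adj G v w)) ∧ (unionSize G v w ≤ᵇ b)) (V G))
                                                             ≡⟨ cong suc (≡.sym (count-nonNbrUnionSeq v b)) ⟩
        suc (count (_≤ᵇ b) (nonNbrUnionSeq G v))             ∎
        where
        open ≤-Reasoning
        reassoc = λ w → ≡.sym (∧-assoc (not (does (v ≟ w))) (not (adj G v w)) _)

  independent⇒size≤p₂ : ∀ {S} → T (independent G S) → S ⊆ V G → length S ≤ p₂ G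
  independent⇒size≤p₂ {S} ind S⊆V = maxUpTo-ub _ (n G)
    (≤⇒≤ᵇ (length≤count (p₂cond G (length S)) S⊆V (All.tabulate (independent⇒p₂cond S⊆V ind))))
    (≤-trans (length-mono-≤ S⊆V) (≤-reflexive length-V))

  subsets-⊆ : ∀ {A : Set} (xs : List A) → All (_⊆ xs) (subsets G xs)
  subsets-⊆ []       = [] ∷ []
  subsets-⊆ (x ∷ xs) =
    All-++⁺ (All.map (x ∷ʳ_) (subsets-⊆ xs)) (All-map⁺ (All.map (refl ∷_) (subsets-⊆ xs)))

  α≤p₂ : α G ≤ p₂ G
  α≤p₂ = maxList-lub _ (All-map⁺ (All.zipWith (uncurry independent⇒size≤p₂)
    ( all-filter (T? ∘ independent G) (subsets G (V G))
    , All-filter⁺ (T? ∘ independent G) (subsets-⊆ (V G)))))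

  p₂count⇒p₁cond : ∀ j → suc j ≤ count (p₂cond G (suc j)) (V G) → T (p₁cond G (suc j))
  p₂count⇒p₁cond j enough =
    p₁cond-intro (suc j) (nth-≤-sorted j (degSeq G) degSeq-sorted low-degrees)
    where
    b = n G ∸ suc j
    low-degrees : suc j ≤ count (_≤ᵇ b) (degSeq G)
    low-degrees = begin
      suc j                                   ≤⟨ enough ⟩
      count (p₂cond G (suc j)) (V G)          ≤⟨ count-mono _ _ (λ u → ≤⇒≤ᵇ ∘ p₂cond⇒deg≤ j u) (V G) ⟩
      count (λ u → deg G u ≤ᵇ b) (V G)        ≡⟨ ≡.sym (count-map (_≤ᵇ b) (deg G) (V G)) ⟩
      count (_≤ᵇ b) (map (deg G) (V G))       ≡⟨ ≡.sym (count-↭ (_≤ᵇ b) (sort-↭ (map (deg G) (V G)))) ⟩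
      count (_≤ᵇ b) (degSeq G)                ∎
      where open ≤-Reasoning

  p₂≤p₁ : p₂ G ≤ p₁ G
  p₂≤p₁ = maxUpTo-lub _ (n G) λ j enough k≤n →
    maxUpTo-ub (p₁cond G) (n G) (p₂count⇒p₁cond j (≤ᵇ⇒≤ _ _ enough)) k≤n

  p₁cond⇒2m≤ : ∀ a → T (p₁cond G (suc a)) →
               2 * edges G ≤ suc a * (n G ∸ suc a) + (n G ∸ suc a) * (n G ∸ 1)
  p₁cond⇒2m≤ a cond with p₁cond-elim (suc a) cond
  ... | d , eq , d≤ = begin
    2 * edges G                                          ≡⟨ ≡.sym handshake ⟩
    sum (map (deg G) (V G))                              ≡⟨ ≡.sym (sum-↭ (sort-↭ (map (deg G) (V G)))) ⟩
    sum (degSeq G)                                       ≤⟨ sum-sorted-≤ a (degSeq G) degSeq-sorted degrees≤ eq ⟩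
    suc a * d + (length (degSeq G) ∸ suc a) * (n G ∸ 1)  ≤⟨ +-mono-≤ (*-monoʳ-≤ (suc a) d≤) (≤-reflexive rest≡) ⟩
    suc a * (n G ∸ suc a) + (n G ∸ suc a) * (n G ∸ 1)    ∎
    where
    open ≤-Reasoning
    degrees≤ : All (_≤ n G ∸ 1) (degSeq G)
    degrees≤ = All-sort (All-map⁺ (All.universal deg≤n∸1 (V G)))
    rest≡ = cong (λ ℓ → (ℓ ∸ suc a) * (n G ∸ 1)) length-degSeq

  p₁≤pG : p₁ G ≤ pG G
  p₁≤pG = maxUpTo-lub (p₁cond G) (n G) λ a cond k≤n →
    suc≤[1+isqrt[1+4y]]/2 a _ (k[k∸1]≤n²∸n∸E (n G) a (2 * edges G) k≤n (p₁cond⇒2m≤ a cond))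

theorem7 : (G : Graph) → α G ≤ p₂ G × p₂ G ≤ p₁ G × p₁ G ≤ pG G
theorem7 G = α≤p₂ G , p₂≤p₁ G , p₁≤pG G
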